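{- Let $p$ be a prime and $n\ge1$, and let $S\subseteq\mathbb{Z}_p^n$ satisfy $1000<|S|<p<\frac{4|S|}{3}$ and $\mathbf{0}\in S$. Then there exists $\mathbf{a}\in\mathbb{Z}_p^n$ such that (1) $|\{\mathbf{y}\in S:\langle\mathbf{y},\mathbf{a}\rangle\equiv0\pmod p\}|\le 6$, and (2) $|\{\langle\mathbf{y},\mathbf{a}\rangle \bmod p:\mathbf{y}\in S\}|\ge\frac{p+2}{3}$.
   Context: $\mathbb{Z}_p$ denotes the integers modulo $p$ and $\langle\cdot,\cdot\rangle$ the standard bilinear form on $\mathbb{Z}_p^n$. -}

module Defs where

open import Data.Nat using (ℕ; module ℕ; _+_; _*_; _%_; NonZero)
open import Data.Nat.Properties using (_≟_)
open import Data.Fin using (Fin; toℕ)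
open import Data.Vec using (Vec; zipWith; foldr; replicate)
import Data.Fin as Fin
open import Data.List using (List; length; map; filter; deduplicate)
open import Relation.Binary.PropositionalEquality using (_≡_)

-- Elements of ℤ_p are Fin p; vectors of ℤ_p^n are Vec (Fin p) n.
-- ⟨ y , a ⟩ mod p, returned as its canonical representative in {0,…,p-1}.
dot : ∀ {n} (p : ℕ) .{{_ : NonZero p}} → Vec (Fin p) n → Vec (Fin p) n → ℕ
dot p y a = foldr _ _+_ 0 (zipWith (λ u v → toℕ u * toℕ v) y a) % p

zeroCount : ∀ {n} (p : ℕ) .{{_ : NonZero p}} → List (Vec (Fin p) n) → Vec (Fin p) n → ℕ
zeroCount p S a = length (filter (λ y → dot p y a ≟ 0) S)

valueCount : ∀ {n} (p : ℕ) .{{_ : NonZero p}} → List (Vec (Fin p) n) → Vec (Fin p) n → ℕ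
valueCount p S a = length (deduplicate _≟_ (map (λ y → dot p y a) S))

zeroVec : ∀ (p : ℕ) .{{_ : NonZero p}} (n : ℕ) → Vec (Fin p) n
zeroVec (ℕ.suc p) n = replicate n Fin.zero

module Submission where

-- Averaging over the p^n directions a.  Two distinct vectors y ≢ y' have ⟨y, a⟩ ≡ ⟨y', a⟩
-- for at most p^(n-1) directions a.  Hence, with s = |S|, the zeros of a on S total at most
-- p^n + (s - 1)p^(n-1) over all a (𝟎 itself contributes p^n), and the pairs of S with equal
-- values total at most C(s, 2)p^(n-1).  So some a has P equal pairs and Z zeros with
--   p·(8P + sZ) + 5s ≤ 5s² + sp,
-- and since s < p < 2s this forces Z ≤ 6 and, as there are V ≥ s - P values, 3V ≥ p + 2.
-- The file develops finite sums, counting of equal pairs, linear congruences modulo a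
-- prime, the counting lemma for linear forms, the averaging step, the numerical estimates,
-- and finally the theorem.

open import Defs
open import Data.Nat
open import Data.Nat.Properties
open import Data.Nat.DivMod
open import Data.Nat.Divisibility using (_∣_; divides; ∣⇒≤)
open import Data.Nat.Primality using (Prime; euclidsLemma)
open import Data.Nat.Tactic.RingSolver using (solve-∀)
open import Data.Fin as Fin using (Fin; toℕ)
open import Data.Fin.Properties using (toℕ-injective; toℕ<n)
open import Data.Vec using (Vec; []; _∷_; foldr; zipWith)
open import Data.Vec.Properties using (≡-dec)
open import Data.List using (List; []; _∷_; length; map; _++_; filter; deduplicate; allFin)
open import Data.List.Properties using (length-map; length-++; length-tabulate; filter-accept; filter-reject)
open import Data.List.Membership.Propositional using (_∈_)
open import Data.List.Relation.Unary.Any using (here; there)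
open import Data.List.Relation.Unary.All as All using (All; []; _∷_)
open import Data.List.Relation.Unary.Unique.Propositional using (Unique; []; _∷_)
open import Data.List.Relation.Unary.Unique.Propositional.Properties using (allFin⁺)
open import Data.Product using (Σ; _×_; _,_; proj₁; proj₂)
open import Data.Sum using (inj₁; inj₂)
open import Data.Empty using (⊥-elim)
open import Function using (id; _∘_)
open import Relation.Nullary using (¬_; Dec; yes; no; ¬?)
open import Relation.Binary using (Tri; tri<; tri≈; tri>)
open import Relation.Binary.Definitions using (DecidableEquality)
open import Relation.Binary.PropositionalEquality

-- Finite sums over lists, written  ∑[ x ∈ xs ] e .  The body of the binder is an
-- argument position, so compound bodies are parenthesised.
sumOver : {A : Set} → List A → (A → ℕ) → ℕ
sumOver []       f = 0
sumOver (x ∷ xs) f = f x + sumOver xs f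

syntax sumOver xs (λ x → e) = ∑[ x ∈ xs ] e

module _ {A : Set} where

  ∑-++ : (xs ys : List A) (f : A → ℕ) → sumOver (xs ++ ys) f ≡ sumOver xs f + sumOver ys f
  ∑-++ []       ys f = refl
  ∑-++ (x ∷ xs) ys f = trans (cong (f x +_) (∑-++ xs ys f)) (sym (+-assoc (f x) _ _))

  ∑-cong : {f g : A → ℕ} → (∀ x → f x ≡ g x) → (xs : List A) → sumOver xs f ≡ sumOver xs g
  ∑-cong f≡g []       = refl
  ∑-cong f≡g (x ∷ xs) = cong₂ _+_ (f≡g x) (∑-cong f≡g xs)

  ∑-mono : {f g : A → ℕ} → (∀ x → f x ≤ g x) → (xs : List A) → sumOver xs f ≤ sumOver xs g
  ∑-mono f≤g []       = z≤n
  ∑-mono f≤g (x ∷ xs) = +-mono-≤ (f≤g x) (∑-mono f≤g xs)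

  ∑-+ : (xs : List A) (f g : A → ℕ) → (∑[ x ∈ xs ] (f x + g x)) ≡ sumOver xs f + sumOver xs g
  ∑-+ []       f g = refl
  ∑-+ (x ∷ xs) f g = trans (cong (f x + g x +_) (∑-+ xs f g)) (interchange (f x) (g x) _ _)
    where
    interchange : ∀ a b c d → a + b + (c + d) ≡ a + c + (b + d)
    interchange = solve-∀

  ∑-* : (k : ℕ) (xs : List A) (f : A → ℕ) → (∑[ x ∈ xs ] (k * f x)) ≡ k * sumOver xs f
  ∑-* k []       f = sym (*-zeroʳ k)
  ∑-* k (x ∷ xs) f = trans (cong (k * f x +_) (∑-* k xs f)) (sym (*-distribˡ-+ k (f x) _))

  ∑-const : (k : ℕ) (xs : List A) → (∑[ x ∈ xs ] k) ≡ length xs * k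
  ∑-const k []       = refl
  ∑-const k (x ∷ xs) = cong (k +_) (∑-const k xs)

  ∑-∈ : (f : A → ℕ) {z : A} {xs : List A} → z ∈ xs → f z ≤ sumOver xs f
  ∑-∈ f (here refl)              = m≤m+n _ _
  ∑-∈ f {xs = x ∷ xs} (there z∈) = ≤-trans (∑-∈ f z∈) (m≤n+m _ (f x))

  ∑-mono-All : {f g : A → ℕ} {xs : List A} → All (λ x → f x ≤ g x) xs → sumOver xs f ≤ sumOver xs g
  ∑-mono-All []           = z≤n
  ∑-mono-All (fx≤gx ∷ f≤g) = +-mono-≤ fx≤gx (∑-mono-All f≤g)

  ∑-at-most-one : (f : A → ℕ) → (∀ x → f x ≤ 1) → (∀ x y → 1 ≤ f x → 1 ≤ f y → x ≡ y) →
                  {xs : List A} → Unique xs → sumOver xs f ≤ 1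
  ∑-at-most-one f f≤1 single []                       = z≤n
  ∑-at-most-one f f≤1 single {x ∷ xs} (x∉xs ∷ unique) with 1 ≤? f x
  ... | no  fx≱1 = +-mono-≤ (≤-pred (≰⇒> fx≱1)) (∑-at-most-one f f≤1 single unique)
  ... | yes fx≥1 = ≤-trans (+-mono-≤ (f≤1 x) (∑-mono-All (All.map vanishes x∉xs)))
                           (≤-reflexive (cong (1 +_) (trans (∑-const 0 xs) (*-zeroʳ (length xs)))))
    where
    vanishes : ∀ {y} → x ≢ y → f y ≤ 0
    vanishes x≢y = ≤-pred (≰⇒> (λ fy≥1 → x≢y (single x _ fx≥1 fy≥1)))

  ∑-one-exception : DecidableEquality A → (f : A → ℕ) (z : A) (B B' : ℕ) →
                    (∀ x → x ≢ z → f x ≤ B) → f z ≤ B' → B ≤ B' →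
                    {xs : List A} → Unique xs → sumOver xs f + B ≤ length xs * B + B'
  ∑-one-exception eq? f z B B' f≤B fz≤B' B≤B' []                      = B≤B'
  ∑-one-exception eq? f z B B' f≤B fz≤B' B≤B' {x ∷ xs} (x∉xs ∷ unique) with eq? x z
  ... | yes refl = begin
    f z + sumOver xs f + B      ≤⟨ +-monoˡ-≤ B (+-mono-≤ fz≤B' (∑-mono-All (All.map (λ z≢y → f≤B _ (≢-sym z≢y)) x∉xs))) ⟩
    B' + (∑[ _ ∈ xs ] B) + B    ≡⟨ cong (λ t → B' + t + B) (∑-const B xs) ⟩
    B' + length xs * B + B      ≡⟨ regroup B' (length xs * B) B ⟩
    B + length xs * B + B'      ∎
    where
    open ≤-Reasoning
    regroup : ∀ a b c → a + b + c ≡ c + b + a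
    regroup = solve-∀
  ... | no  x≢z  = begin
    f x + sumOver xs f + B      ≡⟨ +-assoc (f x) _ B ⟩
    f x + (sumOver xs f + B)    ≤⟨ +-mono-≤ (f≤B x x≢z) (∑-one-exception eq? f z B B' f≤B fz≤B' B≤B' unique) ⟩
    B + (length xs * B + B')    ≡⟨ sym (+-assoc B _ B') ⟩
    B + length xs * B + B'      ∎
    where open ≤-Reasoning

  below-average : (f : A → ℕ) (xs : List A) → 1 ≤ length xs → Σ A (λ a → length xs * f a ≤ sumOver xs f)
  below-average f (x ∷ [])     _ = x , ≤-refl
  below-average f (x ∷ y ∷ xs) _ with below-average f (y ∷ xs) (s≤s z≤n)
  ... | a , bound with f x ≤? f a
  ...   | yes fx≤fa = x , +-monoʳ-≤ (f x) (≤-trans (*-monoʳ-≤ (length (y ∷ xs)) fx≤fa) bound)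
  ...   | no  fx≰fa = a , +-mono-≤ (<⇒≤ (≰⇒> fx≰fa)) bound

∑-map : {A B : Set} (g : A → B) (xs : List A) (f : B → ℕ) → sumOver (map g xs) f ≡ (∑[ x ∈ xs ] f (g x))
∑-map g []       f = refl
∑-map g (x ∷ xs) f = cong (f (g x) +_) (∑-map g xs f)

∑-swap : {A B : Set} (xs : List A) (ys : List B) (f : A → B → ℕ) →
         (∑[ x ∈ xs ] ∑[ y ∈ ys ] f x y) ≡ (∑[ y ∈ ys ] ∑[ x ∈ xs ] f x y)
∑-swap []       ys f = sym (trans (∑-const 0 ys) (*-zeroʳ (length ys)))
∑-swap (x ∷ xs) ys f = trans (cong (sumOver ys (f x) +_) (∑-swap xs ys f))
                             (sym (∑-+ ys (f x) (λ y → ∑[ x ∈ xs ] f x y)))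

indicator : {P : Set} → Dec P → ℕ
indicator (yes _) = 1
indicator (no _)  = 0

δ : ℕ → ℕ → ℕ
δ x y = indicator (x ≟ y)

δ≤1 : ∀ x y → δ x y ≤ 1
δ≤1 x y with x ≟ y
... | yes _ = ≤-refl
... | no  _ = z≤n

δ-≡ : ∀ {x y} → x ≡ y → δ x y ≡ 1
δ-≡ {x} {y} x≡y with x ≟ y
... | yes _   = refl
... | no  x≢y = ⊥-elim (x≢y x≡y)

δ-pos : ∀ {x y} → 1 ≤ δ x y → x ≡ y
δ-pos {x} {y} pos with x ≟ y
... | yes x≡y = x≡y

equalPairs : List ℕ → ℕ
equalPairs []       = 0
equalPairs (x ∷ xs) = (∑[ y ∈ xs ] δ x y) + equalPairs xs

module _ {A : Set} (f : A → ℕ) where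

  ∑-filter-≤ : {P : A → Set} (P? : ∀ x → Dec (P x)) (xs : List A) → sumOver (filter P? xs) f ≤ sumOver xs f
  ∑-filter-≤ P? []       = z≤n
  ∑-filter-≤ P? (x ∷ xs) with P? x
  ... | yes _ = +-monoʳ-≤ (f x) (∑-filter-≤ P? xs)
  ... | no  _ = ≤-trans (∑-filter-≤ P? xs) (m≤n+m _ (f x))

∑-deduplicate-≤ : (f : ℕ → ℕ) (xs : List ℕ) → sumOver (deduplicate _≟_ xs) f ≤ sumOver xs f
∑-deduplicate-≤ f []       = z≤n
∑-deduplicate-≤ f (x ∷ xs) =
  +-monoʳ-≤ (f x) (≤-trans (∑-filter-≤ f (¬? ∘ (x ≟_)) (deduplicate _≟_ xs)) (∑-deduplicate-≤ f xs))

length-split : (x : ℕ) (xs : List ℕ) → length xs ≤ length (filter (¬? ∘ (x ≟_)) xs) + (∑[ y ∈ xs ] δ x y)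
length-split x []       = z≤n
length-split x (y ∷ xs) with x ≟ y
... | yes x≡y rewrite filter-reject (¬? ∘ (x ≟_)) {xs = xs} (λ x≢y → x≢y x≡y) =
  ≤-trans (s≤s (length-split x xs)) (≤-reflexive (sym (+-suc _ _)))
... | no  x≢y rewrite filter-accept (¬? ∘ (x ≟_)) {xs = xs} x≢y = s≤s (length-split x xs)

-- Every entry of xs is either the first occurrence of its value or the second
-- member of an equal pair, so |xs| ≤ #distinct values + #equal pairs.
length≤distinct+equalPairs : (xs : List ℕ) → length xs ≤ length (deduplicate _≟_ xs) + equalPairs xs
length≤distinct+equalPairs []       = z≤n
length≤distinct+equalPairs (x ∷ xs) = s≤s (begin
  length xs                                ≤⟨ length≤distinct+equalPairs xs ⟩
  length ds + equalPairs xs                ≤⟨ +-monoˡ-≤ (equalPairs xs) (length-split x ds) ⟩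
  length rest + (∑[ y ∈ ds ] δ x y) + equalPairs xs
                                           ≤⟨ +-monoˡ-≤ (equalPairs xs) (+-monoʳ-≤ (length rest) (∑-deduplicate-≤ (δ x) xs)) ⟩
  length rest + (∑[ y ∈ xs ] δ x y) + equalPairs xs
                                           ≡⟨ +-assoc (length rest) _ _ ⟩
  length rest + equalPairs (x ∷ xs)        ∎)
  where
  open ≤-Reasoning
  ds rest : List ℕ
  ds   = deduplicate _≟_ xs
  rest = filter (¬? ∘ (x ≟_)) ds

count-as-∑ : {A : Set} (g : A → ℕ) (c : ℕ) (xs : List A) →
             length (filter (λ y → g y ≟ c) xs) ≡ (∑[ y ∈ xs ] δ (g y) c)
count-as-∑ g c []       = refl
count-as-∑ g c (y ∷ xs) with g y ≟ c
... | yes gy≡c rewrite filter-accept (λ y → g y ≟ c) {xs = xs} gy≡c = cong suc (count-as-∑ g c xs)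
... | no  gy≢c rewrite filter-reject (λ y → g y ≟ c) {xs = xs} gy≢c = count-as-∑ g c xs

module Modular (p : ℕ) .{{_ : NonZero p}} where

  %-absorb⇒∣ : ∀ m k → (m + k) % p ≡ m % p → p ∣ k
  %-absorb⇒∣ m k eq = divides ((m + k) / p ∸ m / p) (begin
    k                                                  ≡⟨ sym (m+n∸m≡n m k) ⟩
    m + k ∸ m                                          ≡⟨ cong₂ _∸_ (m≡m%n+[m/n]*n (m + k) p) (m≡m%n+[m/n]*n m p) ⟩
    ((m + k) % p + (m + k) / p * p) ∸ (m % p + m / p * p)
                                                       ≡⟨ cong (λ r → (r + (m + k) / p * p) ∸ (m % p + m / p * p)) eq ⟩
    (m % p + (m + k) / p * p) ∸ (m % p + m / p * p)   ≡⟨ [m+n]∸[m+o]≡n∸o (m % p) _ _ ⟩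
    (m + k) / p * p ∸ m / p * p                        ≡⟨ sym (*-distribʳ-∸ p ((m + k) / p) (m / p)) ⟩
    ((m + k) / p ∸ m / p) * p                          ∎)
    where open ≡-Reasoning

  +-cong-% : ∀ {a b c d} → a % p ≡ b % p → c % p ≡ d % p → (a + c) % p ≡ (b + d) % p
  +-cong-% {a} {b} {c} {d} a≡b c≡d = begin
    (a + c) % p             ≡⟨ %-distribˡ-+ a c p ⟩
    (a % p + c % p) % p     ≡⟨ cong₂ (λ u v → (u + v) % p) a≡b c≡d ⟩
    (b % p + d % p) % p     ≡⟨ sym (%-distribˡ-+ b d p) ⟩
    (b + d) % p             ∎
    where open ≡-Reasoning

  module _ (p-prime : Prime p) where

    ∤-product : ∀ a b → suc a < p → suc b < p → ¬ p ∣ suc a * suc b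
    ∤-product a b a<p b<p p∣ab with euclidsLemma (suc a) (suc b) p-prime p∣ab
    ... | inj₁ p∣a = <⇒≱ a<p (∣⇒≤ p∣a)
    ... | inj₂ p∣b = <⇒≱ b<p (∣⇒≤ p∣b)

    -- The 'crossed' congruence A·x + B·y ≡ B·x + A·y (mod p), shifted by C; it holds
    -- exactly when p ∣ (B - A)(y - x).
    Crossed : ℕ → ℕ → ℕ → ℕ → ℕ → Set
    Crossed A B x y C = (A * x + B * y + C) % p ≡ (B * x + A * y + C) % p

    crossed-swap : ∀ {A B x y C} → Crossed A B x y C → Crossed A B y x C
    crossed-swap {A} {B} {x} {y} {C} crossed = begin
      (A * y + B * x + C) % p  ≡⟨ cong (λ t → (t + C) % p) (+-comm (A * y) (B * x)) ⟩
      (B * x + A * y + C) % p  ≡⟨ sym crossed ⟩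
      (A * x + B * y + C) % p  ≡⟨ cong (λ t → (t + C) % p) (+-comm (A * x) (B * y)) ⟩
      (B * y + A * x + C) % p  ∎
      where open ≡-Reasoning

    -- For A < B < p and x < y < p the crossed congruence fails: the two sides differ
    -- by (B - A)(y - x), a product of nonzero residues.
    ¬crossed : ∀ {A B x y C} → A < B → B < p → x < y → y < p → ¬ Crossed A B x y C
    ¬crossed {A} {x = x} {C = C} A<B B<p x<y y<p crossed
      with m≤n⇒∃[o]m+o≡n A<B | m≤n⇒∃[o]m+o≡n x<y
    ... | a , refl | b , refl =
      ∤-product a b (≤-trans (s≤s (s≤s (m≤n+m a A))) B<p) (≤-trans (s≤s (s≤s (m≤n+m b x))) y<p)
        (%-absorb⇒∣ _ (suc a * suc b) (trans (cong (_% p) (sym (difference A a x b C))) crossed))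
      where
      difference : ∀ A a x b C → A * x + suc (A + a) * suc (x + b) + C
                                 ≡ suc (A + a) * x + A * suc (x + b) + C + suc a * suc b
      difference = solve-∀

    -- A congruence K + A·x ≡ K' + B·x (mod p) with distinct coefficients A ≢ B has at
    -- most one solution x < p: two solutions x, y would give the crossed congruence.
    linear-unique : ∀ {A B K K' x y} → A < p → B < p → A ≢ B → x < p → y < p →
                    (K + A * x) % p ≡ (K' + B * x) % p → (K + A * y) % p ≡ (K' + B * y) % p → x ≡ y
    linear-unique {A} {B} {K} {K'} {x} {y} A<p B<p A≢B x<p y<p at-x at-y = by-order (<-cmp A B) (<-cmp x y)
      where
      left-form : ∀ K A x K' B y → K + A * x + (K' + B * y) ≡ A * x + B * y + (K + K')
      left-form = solve-∀
      right-form : ∀ K A x K' B y → K' + B * x + (K + A * y) ≡ B * x + A * y + (K + K')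
      right-form = solve-∀
      crossed : Crossed A B x y (K + K')
      crossed = subst₂ (λ u v → u % p ≡ v % p) (left-form K A x K' B y) (right-form K A x K' B y)
                  (+-cong-% at-x (sym at-y))
      by-order : Tri (A < B) (A ≡ B) (A > B) → Tri (x < y) (x ≡ y) (x > y) → x ≡ y
      by-order _              (tri≈ _ x≡y _) = x≡y
      by-order (tri≈ _ A≡B _) _              = ⊥-elim (A≢B A≡B)
      by-order (tri< A<B _ _) (tri< x<y _ _) = ⊥-elim (¬crossed A<B B<p x<y y<p crossed)
      by-order (tri< A<B _ _) (tri> _ _ y<x) = ⊥-elim (¬crossed A<B B<p y<x x<p (crossed-swap {A} {B} {x} {y} crossed))
      by-order (tri> _ _ B<A) (tri< x<y _ _) = ⊥-elim (¬crossed {B} {A} {x} {y} B<A A<p x<y y<p (sym crossed))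
      by-order (tri> _ _ B<A) (tri> _ _ y<x) =
        ⊥-elim (¬crossed {B} {A} {y} {x} B<A A<p y<x x<p (sym (crossed-swap {A} {B} {x} {y} crossed)))

module LinearForms (q : ℕ) (p-prime : Prime (suc q)) where

  p : ℕ
  p = suc q

  open Modular p

  rawDot : ∀ {n} → Vec (Fin p) n → Vec (Fin p) n → ℕ
  rawDot y a = foldr _ _+_ 0 (zipWith (λ u v → toℕ u * toℕ v) y a)

  rawDot-zero : ∀ {n} (a : Vec (Fin p) n) → rawDot (zeroVec p n) a ≡ 0
  rawDot-zero []      = refl
  rawDot-zero (x ∷ a) = rawDot-zero a

  prepend : ∀ {n} → List (Fin p) → List (Vec (Fin p) n) → List (Vec (Fin p) (suc n))
  prepend []       vs = []
  prepend (c ∷ cs) vs = map (c ∷_) vs ++ prepend cs vs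

  vectors : ∀ n → List (Vec (Fin p) n)
  vectors zero    = [] ∷ []
  vectors (suc n) = prepend (allFin p) (vectors n)

  ∑-prepend : ∀ {n} (cs : List (Fin p)) (vs : List (Vec (Fin p) n)) (f : Vec (Fin p) (suc n) → ℕ) →
              sumOver (prepend cs vs) f ≡ (∑[ c ∈ cs ] ∑[ v ∈ vs ] f (c ∷ v))
  ∑-prepend []       vs f = refl
  ∑-prepend (c ∷ cs) vs f =
    trans (∑-++ (map (c ∷_) vs) (prepend cs vs) f) (cong₂ _+_ (∑-map (c ∷_) vs f) (∑-prepend cs vs f))

  length-prepend : ∀ {n} (cs : List (Fin p)) (vs : List (Vec (Fin p) n)) →
                   length (prepend cs vs) ≡ length cs * length vs
  length-prepend []       vs = refl
  length-prepend (c ∷ cs) vs =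
    trans (length-++ (map (c ∷_) vs)) (cong₂ _+_ (length-map (c ∷_) vs) (length-prepend cs vs))

  length-allFin : length (allFin p) ≡ p
  length-allFin = length-tabulate id

  length-vectors : ∀ n → length (vectors n) ≡ p ^ n
  length-vectors zero    = refl
  length-vectors (suc n) =
    trans (length-prepend (allFin p) (vectors n)) (cong₂ _*_ length-allFin (length-vectors n))

  ∑-vectors-const : ∀ n k → (∑[ a ∈ vectors n ] k) ≡ p ^ n * k
  ∑-vectors-const n k = trans (∑-const k (vectors n)) (cong (_* k) (length-vectors n))

  agree : ∀ {n} → ℕ → Vec (Fin p) n → ℕ → Vec (Fin p) n → Vec (Fin p) n → ℕ
  agree k y k' y' a = δ ((k + rawDot y a) % p) ((k' + rawDot y' a) % p)

  agree-∷ : ∀ {n} k c (y : Vec (Fin p) n) k' c' y' x a →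
            agree k (c ∷ y) k' (c' ∷ y') (x ∷ a) ≡ agree (k + toℕ c * toℕ x) y (k' + toℕ c' * toℕ x) y' a
  agree-∷ k c y k' c' y' x a =
    cong₂ (λ u v → δ (u % p) (v % p)) (sym (+-assoc k _ (rawDot y a))) (sym (+-assoc k' _ (rawDot y' a)))

  -- Induction on n: if the tails differ, each of the
  -- p values of the first coordinate contributes at most p^(n-2) by induction; if only
  -- the first coefficients c ≢ c' differ, then for each tail at most one first
  -- coordinate solves the resulting linear congruence (linear-unique).
  agreements-bound : ∀ n (y y' : Vec (Fin p) n) → y ≢ y' → ∀ k k' →
                     p * (∑[ a ∈ vectors n ] agree k y k' y' a) ≤ p ^ n
  agreements-bound zero    []      []        []≢[]    k k' = ⊥-elim ([]≢[] refl)
  agreements-bound (suc n) (c ∷ y) (c' ∷ y') cy≢c'y' k k' with ≡-dec Fin._≟_ y y'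
  ... | no y≢y' = begin
    p * sumOver (vectors (suc n)) G                           ≡⟨ cong (p *_) (∑-prepend (allFin p) (vectors n) G) ⟩
    p * (∑[ x ∈ allFin p ] ∑[ a ∈ vectors n ] G (x ∷ a))     ≡⟨ sym (∑-* p (allFin p) _) ⟩
    (∑[ x ∈ allFin p ] (p * (∑[ a ∈ vectors n ] G (x ∷ a)))) ≤⟨ ∑-mono shifted (allFin p) ⟩
    (∑[ x ∈ allFin p ] (p ^ n))                              ≡⟨ ∑-const (p ^ n) (allFin p) ⟩
    length (allFin p) * p ^ n                                ≡⟨ cong (_* p ^ n) length-allFin ⟩
    p * p ^ n                                                ∎
    where
    open ≤-Reasoning
    G : Vec (Fin p) (suc n) → ℕ
    G = agree k (c ∷ y) k' (c' ∷ y')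
    shifted : ∀ x → p * (∑[ a ∈ vectors n ] G (x ∷ a)) ≤ p ^ n
    shifted x = subst (λ t → p * t ≤ p ^ n) (sym (∑-cong (agree-∷ k c y k' c' y' x) (vectors n)))
                      (agreements-bound n y y' y≢y' (k + toℕ c * toℕ x) (k' + toℕ c' * toℕ x))
  ... | yes refl = begin
    p * sumOver (vectors (suc n)) G                       ≡⟨ cong (p *_) (∑-prepend (allFin p) (vectors n) G) ⟩
    p * (∑[ x ∈ allFin p ] ∑[ a ∈ vectors n ] G (x ∷ a)) ≡⟨ cong (p *_) (∑-swap (allFin p) (vectors n) (λ x a → G (x ∷ a))) ⟩
    p * (∑[ a ∈ vectors n ] ∑[ x ∈ allFin p ] G (x ∷ a)) ≤⟨ *-monoʳ-≤ p (∑-mono at-most-one-root (vectors n)) ⟩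
    p * (∑[ a ∈ vectors n ] 1)                           ≡⟨ cong (p *_) (trans (∑-vectors-const n 1) (*-identityʳ (p ^ n))) ⟩
    p * p ^ n                                            ∎
    where
    open ≤-Reasoning
    G : Vec (Fin p) (suc n) → ℕ
    G = agree k (c ∷ y) k' (c' ∷ y)
    regroup : ∀ k u r → k + (u + r) ≡ k + r + u
    regroup k u r = trans (cong (k +_) (+-comm u r)) (sym (+-assoc k r u))
    root : ∀ a x → 1 ≤ G (x ∷ a) →
           (k + rawDot y a + toℕ c * toℕ x) % p ≡ (k' + rawDot y a + toℕ c' * toℕ x) % p
    root a x G≥1 =
      subst₂ (λ u v → u % p ≡ v % p) (regroup k _ (rawDot y a)) (regroup k' _ (rawDot y a)) (δ-pos G≥1)
    c≢c' : toℕ c ≢ toℕ c'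
    c≢c' c≡c' = cy≢c'y' (cong (_∷ y) (toℕ-injective c≡c'))
    at-most-one-root : ∀ a → (∑[ x ∈ allFin p ] G (x ∷ a)) ≤ 1
    at-most-one-root a = ∑-at-most-one (λ x → G (x ∷ a)) (λ x → δ≤1 _ _)
      (λ x x' G≥1 G'≥1 → toℕ-injective
         (linear-unique p-prime {K = k + rawDot y a} {K' = k' + rawDot y a} (toℕ<n c) (toℕ<n c') c≢c'
                        (toℕ<n x) (toℕ<n x') (root a x G≥1) (root a x' G'≥1)))
      (allFin⁺ p)

  coincidences : ∀ {n} → Vec (Fin p) n → Vec (Fin p) n → ℕ
  coincidences {n} y y' = ∑[ a ∈ vectors n ] δ (dot p y a) (dot p y' a)

  coincidences-bound : ∀ {n} (y y' : Vec (Fin p) n) → y ≢ y' → p * coincidences y y' ≤ p ^ n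
  coincidences-bound {n} y y' y≢y' = agreements-bound n y y' y≢y' 0 0

  coincidences-≤ : ∀ {n} (y y' : Vec (Fin p) n) → coincidences y y' ≤ p ^ n
  coincidences-≤ {n} y y' =
    ≤-trans (∑-mono (λ a → δ≤1 _ _) (vectors n)) (≤-reflexive (trans (∑-vectors-const n 1) (*-identityʳ (p ^ n))))

module Averaging (q : ℕ) (p-prime : Prime (suc q)) (n : ℕ) where

  open LinearForms q p-prime

  N : ℕ
  N = p ^ n

  dot-zero : (a : Vec (Fin p) n) → dot p (zeroVec p n) a ≡ 0
  dot-zero a = cong (_% p) (rawDot-zero a)

  zeroCount-as-∑ : (S : List (Vec (Fin p) n)) (a : Vec (Fin p) n) →
                   zeroCount p S a ≡ (∑[ y ∈ S ] δ (dot p y a) (dot p (zeroVec p n) a))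
  zeroCount-as-∑ S a =
    trans (count-as-∑ (λ y → dot p y a) 0 S) (∑-cong (λ y → cong (δ (dot p y a)) (sym (dot-zero a))) S)

  zeroCount-pos : (S : List (Vec (Fin p) n)) (a : Vec (Fin p) n) → zeroVec p n ∈ S → 1 ≤ zeroCount p S a
  zeroCount-pos S a 0∈S = subst (1 ≤_) (sym (zeroCount-as-∑ S a))
    (≤-trans (≤-reflexive (sym (δ-≡ refl))) (∑-∈ (λ y → δ (dot p y a) (dot p (zeroVec p n) a)) 0∈S))

  -- ∑_a zeroCount S a ≤ p^n + (|S| - 1)·p^(n-1): the zero vector contributes p^n and
  -- every other y ∈ S at most p^(n-1).
  total-zeros : (S : List (Vec (Fin p) n)) → Unique S →
                p * (∑[ a ∈ vectors n ] zeroCount p S a) + N ≤ length S * N + p * N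
  total-zeros S unique = begin
    p * (∑[ a ∈ vectors n ] zeroCount p S a) + N     ≡⟨ cong (λ t → p * t + N) by-point ⟩
    p * (∑[ y ∈ S ] coincidences y 0v) + N           ≡⟨ cong (_+ N) (sym (∑-* p S _)) ⟩
    (∑[ y ∈ S ] (p * coincidences y 0v)) + N         ≤⟨ ∑-one-exception (≡-dec Fin._≟_) (λ y → p * coincidences y 0v) 0v N (p * N)
                                                          (λ y y≢0 → coincidences-bound y 0v y≢0)
                                                          (*-monoʳ-≤ p (coincidences-≤ 0v 0v))
                                                          (m≤m+n N (q * N)) unique ⟩
    length S * N + p * N                             ∎
    where
    open ≤-Reasoning
    0v : Vec (Fin p) n
    0v = zeroVec p n
    by-point : (∑[ a ∈ vectors n ] zeroCount p S a) ≡ (∑[ y ∈ S ] coincidences y 0v)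
    by-point = trans (∑-cong (zeroCount-as-∑ S) (vectors n)) (∑-swap (vectors n) S _)

  equalPairsAt : List (Vec (Fin p) n) → Vec (Fin p) n → ℕ
  equalPairsAt S a = equalPairs (map (λ y → dot p y a) S)

  -- ∑_a equalPairsAt S a ≤ C(|S|, 2)·p^(n-1), each pair of distinct vectors agreeing
  -- in at most p^(n-1) directions; stated multiplied by 2p to stay in ℕ.
  total-pairs : (S : List (Vec (Fin p) n)) → Unique S →
                2 * (p * (∑[ a ∈ vectors n ] equalPairsAt S a)) + length S * N ≤ length S * length S * N
  total-pairs [] [] = ≤-reflexive (begin
    2 * (p * (∑[ a ∈ vectors n ] 0)) + 0    ≡⟨ cong (λ t → 2 * (p * t) + 0) (trans (∑-vectors-const n 0) (*-zeroʳ N)) ⟩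
    2 * (p * 0) + 0                         ≡⟨ cong (λ t → 2 * t + 0) (*-zeroʳ p) ⟩
    0                                       ∎)
    where open ≡-Reasoning
  total-pairs (y ∷ S) (y∉S ∷ unique) = begin
    2 * (p * (∑[ a ∈ vectors n ] equalPairsAt (y ∷ S) a)) + suc s * N
                                            ≡⟨ cong (λ t → 2 * (p * t) + suc s * N) split ⟩
    2 * (p * (X + Y)) + suc s * N           ≡⟨ regroup p X Y s N ⟩
    2 * (p * X) + (2 * (p * Y) + s * N) + N ≤⟨ +-monoˡ-≤ N (+-mono-≤ (*-monoʳ-≤ 2 new-pairs) (total-pairs S unique)) ⟩
    2 * (s * N) + s * s * N + N             ≡⟨ square s N ⟩
    suc s * suc s * N                       ∎
    where
    open ≤-Reasoning
    s X Y : ℕ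
    s = length S
    X = ∑[ a ∈ vectors n ] ∑[ y' ∈ S ] δ (dot p y a) (dot p y' a)
    Y = ∑[ a ∈ vectors n ] equalPairsAt S a
    split : (∑[ a ∈ vectors n ] equalPairsAt (y ∷ S) a) ≡ X + Y
    split = trans (∑-cong (λ a → cong (_+ equalPairsAt S a) (∑-map (λ y → dot p y a) S (δ (dot p y a))))
                          (vectors n))
                  (∑-+ (vectors n) _ (equalPairsAt S))
    new-pairs : p * X ≤ s * N
    new-pairs = begin
      p * X                                  ≡⟨ cong (p *_) (∑-swap (vectors n) S _) ⟩
      p * (∑[ y' ∈ S ] coincidences y y')    ≡⟨ sym (∑-* p S _) ⟩
      (∑[ y' ∈ S ] (p * coincidences y y'))  ≤⟨ ∑-mono-All (All.map (coincidences-bound y _) y∉S) ⟩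
      (∑[ y' ∈ S ] N)                        ≡⟨ ∑-const N S ⟩
      s * N                                  ∎
    regroup : ∀ p X Y s N → 2 * (p * (X + Y)) + suc s * N ≡ 2 * (p * X) + (2 * (p * Y) + s * N) + N
    regroup = solve-∀
    square : ∀ s N → 2 * (s * N) + s * s * N + N ≡ suc s * suc s * N
    square = solve-∀

  weight : List (Vec (Fin p) n) → Vec (Fin p) n → ℕ
  weight S a = 8 * equalPairsAt S a + length S * zeroCount p S a

  good-direction : (S : List (Vec (Fin p) n)) → Unique S →
                   Σ (Vec (Fin p) n) (λ a → p * (8 * equalPairsAt S a + length S * zeroCount p S a) + 5 * length S
                                             ≤ 5 * (length S * length S) + length S * p)
  good-direction S unique with below-average (weight S) (vectors n) (subst (1 ≤_) (sym (length-vectors n)) (m^n>0 p n))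
  ... | a , below = a , *-cancelˡ-≤ N {{m^n≢0 p n}} (begin
    N * (p * weight S a + 5 * s)                   ≡⟨ regroup₁ N p (weight S a) s ⟩
    p * (N * weight S a) + 5 * s * N               ≤⟨ +-monoˡ-≤ (5 * s * N) (*-monoʳ-≤ p below-N) ⟩
    p * (∑[ b ∈ vectors n ] weight S b) + 5 * s * N ≡⟨ cong (λ t → p * t + 5 * s * N) total-weight ⟩
    p * (8 * ΣP + s * ΣZ) + 5 * s * N              ≡⟨ regroup₂ p ΣP s ΣZ N ⟩
    4 * (2 * (p * ΣP) + s * N) + s * (p * ΣZ + N)  ≤⟨ +-mono-≤ (*-monoʳ-≤ 4 (total-pairs S unique)) (*-monoʳ-≤ s (total-zeros S unique)) ⟩
    4 * (s * s * N) + s * (s * N + p * N)          ≡⟨ regroup₃ s N p ⟩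
    N * (5 * (s * s) + s * p)                      ∎)
    where
    open ≤-Reasoning
    s ΣP ΣZ : ℕ
    s  = length S
    ΣP = ∑[ b ∈ vectors n ] equalPairsAt S b
    ΣZ = ∑[ b ∈ vectors n ] zeroCount p S b
    below-N : N * weight S a ≤ (∑[ b ∈ vectors n ] weight S b)
    below-N = subst (λ m → m * weight S a ≤ sumOver (vectors n) (weight S)) (length-vectors n) below
    total-weight : (∑[ b ∈ vectors n ] weight S b) ≡ 8 * ΣP + s * ΣZ
    total-weight = trans (∑-+ (vectors n) _ _) (cong₂ _+_ (∑-* 8 (vectors n) _) (∑-* s (vectors n) _))
    regroup₁ : ∀ N p w s → N * (p * w + 5 * s) ≡ p * (N * w) + 5 * s * N
    regroup₁ = solve-∀
    regroup₂ : ∀ p P s Z N → p * (8 * P + s * Z) + 5 * s * N ≡ 4 * (2 * (p * P) + s * N) + s * (p * Z + N)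
    regroup₂ = solve-∀
    regroup₃ : ∀ s N p → 4 * (s * s * N) + s * (s * N + p * N) ≡ N * (5 * (s * s) + s * p)
    regroup₃ = solve-∀

  distinct-values : (S : List (Vec (Fin p) n)) (a : Vec (Fin p) n) →
                    length S ≤ valueCount p S a + equalPairsAt S a
  distinct-values S a = subst (_≤ valueCount p S a + equalPairsAt S a) (length-map (λ y → dot p y a) S)
                              (length≤distinct+equalPairs (map (λ y → dot p y a) S))

-- The numerical conclusions.  From the averaged inequality with s ≤ p: at most six zeros,
-- since seven would give 6ps + 5s ≤ 5s² ≤ 5ps.
few-zeros : ∀ {s p P Z} → 1 ≤ s → s ≤ p →
            p * (8 * P + s * Z) + 5 * s ≤ 5 * (s * s) + s * p → Z ≤ 6
few-zeros {s} {p} {P} {Z} 1≤s s≤p averaged with Z ≤? 6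
... | yes Z≤6 = Z≤6
... | no  Z≰6 = ⊥-elim (<-irrefl refl (begin-strict
  6 * (p * s)           <⟨ m<m+n (6 * (p * s)) (≤-trans (s≤s z≤n) (*-monoʳ-≤ 5 1≤s)) ⟩
  6 * (p * s) + 5 * s   ≤⟨ +-cancelʳ-≤ (s * p) _ _ seven-zeros ⟩
  5 * (s * s)           ≤⟨ *-monoʳ-≤ 5 (*-monoˡ-≤ s s≤p) ⟩
  5 * (p * s)           ≤⟨ *-monoˡ-≤ (p * s) (n≤1+n 5) ⟩
  6 * (p * s)           ∎))
  where
  open ≤-Reasoning
  regroup : ∀ p s → 6 * (p * s) + 5 * s + s * p ≡ p * (s * 7) + 5 * s
  regroup = solve-∀
  seven-zeros : 6 * (p * s) + 5 * s + s * p ≤ 5 * (s * s) + s * p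
  seven-zeros = begin
    6 * (p * s) + 5 * s + s * p  ≡⟨ regroup p s ⟩
    p * (s * 7) + 5 * s          ≤⟨ +-monoˡ-≤ (5 * s) (*-monoʳ-≤ p (≤-trans (*-monoʳ-≤ s (≰⇒> Z≰6)) (m≤n+m _ _))) ⟩
    p * (8 * P + s * Z) + 5 * s  ≤⟨ averaged ⟩
    5 * (s * s) + s * p          ∎

-- The estimate behind (2): for s ≤ p < 2s,  8p(p + 1) + 15s² < 24ps + 15s.
-- Writing p = s + d and s = d + 1 + e, the difference is an explicit positive polynomial.
quadratic-gap : ∀ {s p} → s ≤ p → p < 2 * s → 8 * (p * (p + 1)) + 15 * (s * s) < 24 * (p * s) + 15 * s
quadratic-gap {s} {p} s≤p p<2s with m≤n⇒∃[o]m+o≡n s≤p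
... | d , refl with m≤n⇒∃[o]m+o≡n (+-cancelˡ-< s d s (subst (s + d <_) (cong (s +_) (+-identityʳ s)) p<2s))
... | e , refl = begin-strict
  8 * (p * (p + 1)) + 15 * (s * s)            <⟨ m<m+n _ (s≤s z≤n) ⟩
  8 * (p * (p + 1)) + 15 * (s * s) + surplus  ≡⟨ expand d e ⟩
  24 * (p * s) + 15 * s                       ∎
  where
  open ≤-Reasoning
  surplus : ℕ
  surplus = suc (d + e) * suc (d + e) + 7 * d + 8 * (d * e) + 7 + 7 * e
  expand : ∀ d e → let s = suc (d + e) ; p = s + d in
           8 * (p * (p + 1)) + 15 * (s * s) + (s * s + 7 * d + 8 * (d * e) + 7 + 7 * e) ≡ 24 * (p * s) + 15 * s
  expand = solve-∀

-- With at least one zero, the averaged inequality gives 8p·P + 5s ≤ 5s² for the number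
-- P of equal pairs; if moreover 3V ≤ p + 1 for the number V ≥ s - P of values, then
-- 24ps + 15s ≤ 8p(p + 1) + 15s², contradicting quadratic-gap.
many-values : ∀ {s p P Z V} → 1 ≤ Z → s ≤ p → p < 2 * s →
              p * (8 * P + s * Z) + 5 * s ≤ 5 * (s * s) + s * p → s ≤ V + P → p + 2 ≤ 3 * V
many-values {s} {p} {P} {Z} {V} 1≤Z s≤p p<2s averaged s≤V+P with p + 2 ≤? 3 * V
... | yes enough = enough
... | no  short  = ⊥-elim (<-irrefl refl (begin-strict
  8 * (p * (p + 1)) + 15 * (s * s)           <⟨ quadratic-gap s≤p p<2s ⟩
  24 * (p * s) + 15 * s                      ≡⟨ regroup₁ p s ⟩
  8 * (p * (3 * s)) + 15 * s                 ≤⟨ +-monoˡ-≤ (15 * s) (*-monoʳ-≤ 8 (*-monoʳ-≤ p few-values)) ⟩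
  8 * (p * (p + 1 + 3 * P)) + 15 * s         ≡⟨ regroup₂ p P s ⟩
  8 * (p * (p + 1)) + 3 * (8 * (p * P) + 5 * s)
                                             ≤⟨ +-monoʳ-≤ (8 * (p * (p + 1))) (*-monoʳ-≤ 3 few-pairs) ⟩
  8 * (p * (p + 1)) + 3 * (5 * (s * s))      ≡⟨ cong (8 * (p * (p + 1)) +_) (sym (*-assoc 3 5 (s * s))) ⟩
  8 * (p * (p + 1)) + 15 * (s * s)           ∎))
  where
  open ≤-Reasoning
  regroup₁ : ∀ p s → 24 * (p * s) + 15 * s ≡ 8 * (p * (3 * s)) + 15 * s
  regroup₁ = solve-∀
  regroup₂ : ∀ p P s → 8 * (p * (p + 1 + 3 * P)) + 15 * s ≡ 8 * (p * (p + 1)) + 3 * (8 * (p * P) + 5 * s)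
  regroup₂ = solve-∀
  regroup₃ : ∀ p P s → 8 * (p * P) + 5 * s + s * p ≡ p * (8 * P + s * 1) + 5 * s
  regroup₃ = solve-∀
  few-pairs : 8 * (p * P) + 5 * s ≤ 5 * (s * s)
  few-pairs = +-cancelʳ-≤ (s * p) _ _ (begin
    8 * (p * P) + 5 * s + s * p  ≡⟨ regroup₃ p P s ⟩
    p * (8 * P + s * 1) + 5 * s  ≤⟨ +-monoˡ-≤ (5 * s) (*-monoʳ-≤ p (+-monoʳ-≤ (8 * P) (*-monoʳ-≤ s 1≤Z))) ⟩
    p * (8 * P + s * Z) + 5 * s  ≤⟨ averaged ⟩
    5 * (s * s) + s * p          ∎)
  few-values : 3 * s ≤ p + 1 + 3 * P
  few-values = begin
    3 * s          ≤⟨ *-monoʳ-≤ 3 s≤V+P ⟩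
    3 * (V + P)    ≡⟨ *-distribˡ-+ 3 V P ⟩
    3 * V + 3 * P  ≤⟨ +-monoˡ-≤ (3 * P) (≤-pred (subst (3 * V <_) (+-suc p 1) (≰⇒> short))) ⟩
    p + 1 + 3 * P  ∎

lemma4p3 : (p : ℕ) .{{_ : NonZero p}} → Prime p → (n : ℕ) → 1 ≤ n →
           (S : List (Vec (Fin p) n)) → Unique S →
           1000 < length S → length S < p → 3 * p < 4 * length S →
           zeroVec p n ∈ S →
           Σ (Vec (Fin p) n) (λ a → (zeroCount p S a ≤ 6) × (p + 2 ≤ 3 * valueCount p S a))
lemma4p3 (suc q) p-prime n _ S unique 1000<s s<p 3p<4s 0∈S =
  a , few-zeros {P = P} {Z = Z} 1≤s (<⇒≤ s<p) averaged
    , many-values {P = P} {Z = Z} {V = V} (zeroCount-pos S a 0∈S) (<⇒≤ s<p) p<2s averaged (distinct-values S a)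
  where
  open Averaging q p-prime n
  s : ℕ
  s = length S
  a : Vec (Fin (suc q)) n
  a = proj₁ (good-direction S unique)
  P Z V : ℕ
  P = equalPairsAt S a
  Z = zeroCount (suc q) S a
  V = valueCount (suc q) S a
  averaged : suc q * (8 * P + s * Z) + 5 * s ≤ 5 * (s * s) + s * suc q
  averaged = proj₂ (good-direction S unique)
  1≤s : 1 ≤ s
  1≤s = ≤-trans (s≤s z≤n) 1000<s
  p<2s : suc q < 2 * s
  p<2s = *-cancelˡ-< 3 (suc q) (2 * s)
           (≤-trans 3p<4s (≤-trans (*-monoˡ-≤ s (m≤m+n 4 2)) (≤-reflexive (*-assoc 3 2 s))))
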